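{- Let $A\in\mathbb{R}^{n\times n}$ be a P-matrix. Then the matrix $$M=\begin{pmatrix} A & A+I\\ A-I & A\end{pmatrix}\in\mathbb{R}^{2n\times 2n}$$ is also a P-matrix, where $I$ is the $n\times n$ identity matrix.
   Context: A P-matrix is a square real matrix all of whose principal minors are positive. -}

module Defs where

open import Level using (Level; _⊔_) renaming (suc to lsuc)
open import Data.Nat using (ℕ; zero; suc) renaming (_+_ to _+ℕ_)
open import Data.Fin using (Fin; zero; suc; splitAt; punchIn; _≟_)
import Data.Fin as F
open import Data.Sum using (_⊎_; inj₁; inj₂)
open import Data.Product using (∃-syntax)
open import Relation.Nullary using (¬_; yes; no)
open import Algebra.Bundles using (CommutativeRing)

-- An ordered field: a commutative ring with multiplicative inverses of
-- nonzero elements, and a strict total order compatible with + and *.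
-- (The real numbers are the intended instance.)
record OrderedField (c ℓ : Level) : Set (lsuc (c ⊔ ℓ)) where
  field
    commutativeRing : CommutativeRing c ℓ
  open CommutativeRing commutativeRing public
  field
    0≉1       : ¬ (0# ≈ 1#)
    inverse   : ∀ x → ¬ (x ≈ 0#) → ∃[ y ] (x * y ≈ 1#)
    _<_       : Carrier → Carrier → Set ℓ
    <-resp-≈  : ∀ {a b c d} → a ≈ b → c ≈ d → a < c → b < d
    <-irrefl  : ∀ {a} → ¬ (a < a)
    <-trans   : ∀ {a b c} → a < b → b < c → a < c
    <-tri     : ∀ a b → a < b ⊎ (a ≈ b ⊎ b < a)
    +-mono-<  : ∀ {a b} c → a < b → (a + c) < (b + c)
    *-pos     : ∀ {a b} → 0# < a → 0# < b → 0# < (a * b)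

module Matrices {c ℓ} (K : OrderedField c ℓ) where
  open OrderedField K using (Carrier; 0#; 1#; _+_; _*_; -_; _-_; _<_)

  Matrix : ℕ → Set c
  Matrix n = Fin n → Fin n → Carrier

  ∑ : ∀ {n} → (Fin n → Carrier) → Carrier
  ∑ {zero}  f = 0#
  ∑ {suc n} f = f zero + ∑ (λ i → f (suc i))

  sgn : ℕ → Carrier
  sgn zero    = 1#
  sgn (suc k) = - sgn k

  det : ∀ {n} → Matrix n → Carrier
  det {zero}  M = 1#
  det {suc n} M =
    ∑ (λ j → sgn (F.toℕ j) * (M zero j * det (λ a b → M (suc a) (punchIn j b))))

  StrictlyIncreasing : ∀ {k n} → (Fin k → Fin n) → Set
  StrictlyIncreasing σ = ∀ i j → i F.< j → σ i F.< σ j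

  principalSubmatrix : ∀ {k n} → Matrix n → (Fin k → Fin n) → Matrix k
  principalSubmatrix A σ i j = A (σ i) (σ j)

  -- P-matrix: every principal minor (nonempty index set) is positive
  IsPMatrix : ∀ {n} → Matrix n → Set ℓ
  IsPMatrix {n} A = ∀ k (σ : Fin (suc k) → Fin n) → StrictlyIncreasing σ →
    0# < det (principalSubmatrix A σ)

  identity : ∀ {n} → Matrix n
  identity i j with i ≟ j
  ... | yes _ = 1#
  ... | no  _ = 0#

  _⊕_ _⊖_ : ∀ {n} → Matrix n → Matrix n → Matrix n
  (A ⊕ B) i j = A i j + B i j
  (A ⊖ B) i j = A i j - B i j

  block : ∀ {n} → Matrix n → Matrix n → Matrix n → Matrix n → Matrix (n +ℕ n)
  block {n} P Q R S i j with splitAt n i | splitAt n j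
  ... | inj₁ a | inj₁ b = P a b
  ... | inj₁ a | inj₂ b = Q a b
  ... | inj₂ a | inj₁ b = R a b
  ... | inj₂ a | inj₂ b = S a b

{-# OPTIONS --safe #-}
-- A principal submatrix M[S] is indexed by a set S of indices from the two copies of
-- {1, …, n}. If S contains no pair {i, n + i}, the identity blocks contribute nothing to
-- M[S], which after a simultaneous reordering of rows and columns is a principal submatrix
-- of A. If S contains such a pair, row n + i is row i minus (e_i + e_(n+i)), and outside
-- these two rows the columns i and n + i agree; subtracting rows and expanding shows
-- det M[S] = det M[S ∖ {i, n + i}], and induction on |S| finishes the proof.
module Submission where

open import Defs
open import Data.Nat using (ℕ; zero; suc; s<s)
open import Data.Fin using (Fin; zero; suc; punchIn; punchOut; toℕ; splitAt; join)
import Data.Fin.Properties as Fin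
open import Data.List using (List; []; _∷_; _++_; map)
open import Data.Product using (∃-syntax; _,_; _×_)
open import Data.Sum using (_⊎_; inj₁; inj₂)
open import Function using (_∘_)
open import Function.Definitions using (Injective)
open import Relation.Binary.Definitions using (tri<; tri≈; tri>)
import Relation.Binary.PropositionalEquality as ≡
open ≡ using (_≡_; _≢_)
open import Relation.Nullary using (¬_; Dec; yes; no; contradiction)

module _ where
  open ≡
  open import Data.Fin using (_≤_; _<_)

  swap₀₁ : ∀ {m} → Fin (suc (suc m)) → Fin (suc (suc m))
  swap₀₁ zero          = suc zero
  swap₀₁ (suc zero)    = zero
  swap₀₁ (suc (suc i)) = suc (suc i)

  swapAt : ∀ {m} → Fin m → Fin (suc m) → Fin (suc m)
  swapAt {suc m} zero    i       = swap₀₁ i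
  swapAt         (suc k) zero    = zero
  swapAt         (suc k) (suc i) = suc (swapAt k i)

  swapAt-involutive : ∀ {m} (k : Fin m) i → swapAt k (swapAt k i) ≡ i
  swapAt-involutive {suc m} zero zero          = refl
  swapAt-involutive {suc m} zero (suc zero)    = refl
  swapAt-involutive {suc m} zero (suc (suc i)) = refl
  swapAt-involutive (suc k) zero    = refl
  swapAt-involutive (suc k) (suc i) = cong suc (swapAt-involutive k i)

  applySwaps : ∀ {m} → List (Fin m) → Fin (suc m) → Fin (suc m)
  applySwaps []       i = i
  applySwaps (k ∷ ks) i = swapAt k (applySwaps ks i)

  applySwaps-++ : ∀ {m} (ks ls : List (Fin m)) i →
    applySwaps (ks ++ ls) i ≡ applySwaps ks (applySwaps ls i)
  applySwaps-++ []       ls i = refl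
  applySwaps-++ (k ∷ ks) ls i = cong (swapAt k) (applySwaps-++ ks ls i)

  applySwaps-map-suc-zero : ∀ {m} (ks : List (Fin m)) → applySwaps (map suc ks) zero ≡ zero
  applySwaps-map-suc-zero []       = refl
  applySwaps-map-suc-zero (k ∷ ks) = cong (swapAt (suc k)) (applySwaps-map-suc-zero ks)

  applySwaps-map-suc-suc : ∀ {m} (ks : List (Fin m)) i →
    applySwaps (map suc ks) (suc i) ≡ suc (applySwaps ks i)
  applySwaps-map-suc-suc []       i = refl
  applySwaps-map-suc-suc (k ∷ ks) i = cong (swapAt (suc k)) (applySwaps-map-suc-suc ks i)

  applySwaps-injective : ∀ {m} (ks : List (Fin m)) → Injective _≡_ _≡_ (applySwaps ks)
  applySwaps-injective []       eq = eq
  applySwaps-injective (k ∷ ks) {i} {j} eq = applySwaps-injective ks (begin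
    applySwaps ks i                       ≡⟨ swapAt-involutive k _ ⟨
    swapAt k (swapAt k (applySwaps ks i)) ≡⟨ cong (swapAt k) eq ⟩
    swapAt k (swapAt k (applySwaps ks j)) ≡⟨ swapAt-involutive k _ ⟩
    applySwaps ks j                       ∎)
    where open ≡-Reasoning

  moveTo : ∀ {m} → Fin (suc m) → List (Fin m)
  moveTo zero            = []
  moveTo {suc m} (suc p) = map suc (moveTo p) ++ zero ∷ []

  applySwaps-moveTo-zero : ∀ {m} (p : Fin (suc m)) → applySwaps (moveTo p) zero ≡ p
  applySwaps-moveTo-zero zero            = refl
  applySwaps-moveTo-zero {suc m} (suc p) =
    trans (applySwaps-++ (map suc (moveTo p)) (zero ∷ []) zero)
          (trans (applySwaps-map-suc-suc (moveTo p) zero) (cong suc (applySwaps-moveTo-zero p)))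

  applySwaps-moveTo-suc : ∀ {m} (p : Fin (suc m)) i → applySwaps (moveTo p) (suc i) ≡ punchIn p i
  applySwaps-moveTo-suc zero            i       = refl
  applySwaps-moveTo-suc {suc m} (suc p) zero    =
    trans (applySwaps-++ (map suc (moveTo p)) (zero ∷ []) (suc zero)) (applySwaps-map-suc-zero (moveTo p))
  applySwaps-moveTo-suc {suc m} (suc p) (suc i) =
    trans (applySwaps-++ (map suc (moveTo p)) (zero ∷ []) (suc (suc i)))
          (trans (applySwaps-map-suc-suc (moveTo p) (suc i)) (cong suc (applySwaps-moveTo-suc p i)))

  _◃_ : ∀ {m} → Fin (suc (suc m)) → List (Fin m) → List (Fin (suc m))
  p ◃ ks = moveTo p ++ map suc ks

  ◃-zero : ∀ {m} (p : Fin (suc (suc m))) ks → applySwaps (p ◃ ks) zero ≡ p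
  ◃-zero p ks = trans (applySwaps-++ (moveTo p) (map suc ks) zero)
    (trans (cong (applySwaps (moveTo p)) (applySwaps-map-suc-zero ks)) (applySwaps-moveTo-zero p))

  ◃-suc : ∀ {m} (p : Fin (suc (suc m))) ks i →
    applySwaps (p ◃ ks) (suc i) ≡ punchIn p (applySwaps ks i)
  ◃-suc p ks i = trans (applySwaps-++ (moveTo p) (map suc ks) (suc i))
                       (trans (cong (applySwaps (moveTo p)) (applySwaps-map-suc-suc ks i))
                              (applySwaps-moveTo-suc p (applySwaps ks i)))

  argmin : ∀ {n k} (δ : Fin (suc k) → Fin n) → ∃[ p ] (∀ j → δ p ≤ δ j)
  argmin {k = zero}  δ = zero , λ { zero → Fin.≤-refl }
  argmin {k = suc k} δ with argmin (δ ∘ suc)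
  ... | p , min with Fin.≤-total (δ zero) (δ (suc p))
  ...   | inj₁ δ₀≤ = zero  , λ { zero → Fin.≤-refl ; (suc j) → Fin.≤-trans δ₀≤ (min j) }
  ...   | inj₂ ≤δ₀ = suc p , λ { zero → ≤δ₀ ; (suc j) → min j }

  sortingSwaps : ∀ {n k} (δ : Fin (suc k) → Fin n) → Injective _≡_ _≡_ δ →
    ∃[ ks ] (∀ i j → i < j → δ (applySwaps ks i) < δ (applySwaps ks j))
  sortingSwaps {k = zero}  δ δ-inj = [] , λ { zero zero () }
  sortingSwaps {k = suc k} δ δ-inj with argmin δ
  ... | p , min with sortingSwaps (δ ∘ punchIn p) (Fin.punchIn-injective p _ _ ∘ δ-inj)
  ...   | ks , sorted = p ◃ ks , increasing
    where
    increasing : ∀ i j → i < j → δ (applySwaps (p ◃ ks) i) < δ (applySwaps (p ◃ ks) j)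
    increasing zero    zero    ()
    increasing (suc i) zero    ()
    increasing zero (suc j) _ rewrite ◃-zero p ks | ◃-suc p ks j =
      Fin.≤∧≢⇒< (min _) (Fin.punchInᵢ≢i p _ ∘ sym ∘ δ-inj)
    increasing (suc i) (suc j) (s<s i<j) rewrite ◃-suc p ks i | ◃-suc p ks j = sorted i j i<j

  strictlyIncreasing⇒injective : ∀ {k n} (σ : Fin k → Fin n) →
    (∀ i j → i < j → σ i < σ j) → Injective _≡_ _≡_ σ
  strictlyIncreasing⇒injective σ increasing {i} {j} σi≡σj with Fin.<-cmp i j
  ... | tri< i<j _ _ = contradiction σi≡σj (Fin.<⇒≢ (increasing i j i<j))
  ... | tri≈ _ i≡j _ = i≡j
  ... | tri> _ _ j<i = contradiction (sym σi≡σj) (Fin.<⇒≢ (increasing j i j<i))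

  splitAt-injective : ∀ m {n} → Injective _≡_ _≡_ (splitAt m {n})
  splitAt-injective m {n} {i} {j} eq =
    trans (sym (Fin.join-splitAt m n i)) (trans (cong (join m n) eq) (Fin.join-splitAt m n j))

module OrderedFieldProperties {c ℓ} (K : OrderedField c ℓ) where
  open OrderedField K
  open import Algebra.Properties.Ring ring using (-‿distribˡ-*; -‿distribʳ-*; -‿involutive)

  <-irrefl-≈ : ∀ {x y} → x ≈ y → ¬ (x < y)
  <-irrefl-≈ x≈y x<y = <-irrefl (<-resp-≈ refl (sym x≈y) x<y)

  0<1 : 0# < 1#
  0<1 with <-tri 0# 1#
  ... | inj₁ 0<1          = 0<1
  ... | inj₂ (inj₁ 0≈1)   = contradiction 0≈1 0≉1
  ... | inj₂ (inj₂ 1<0)   = contradiction (<-trans 1<0 0<1′) (<-irrefl-≈ refl)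
    where
    0<-1 : 0# < (- 1#)
    0<-1 = <-resp-≈ (-‿inverseʳ 1#) (+-identityˡ _) (+-mono-< (- 1#) 1<0)
    -1*-1≈1 : - 1# * - 1# ≈ 1#
    -1*-1≈1 = trans (sym (-‿distribˡ-* _ _)) (trans (-‿cong (sym (-‿distribʳ-* _ _)))
                (trans (-‿involutive _) (*-identityˡ 1#)))
    0<1′ : 0# < 1#
    0<1′ = <-resp-≈ refl -1*-1≈1 (*-pos 0<-1 0<-1)

  x+x≈0⇒x≈0 : ∀ {x} → x + x ≈ 0# → x ≈ 0#
  x+x≈0⇒x≈0 {x} x+x≈0 with <-tri x 0#
  ... | inj₁ x<0        =
    contradiction (<-trans (<-resp-≈ x+x≈0 (+-identityˡ x) (+-mono-< x x<0)) x<0) (<-irrefl-≈ refl)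
  ... | inj₂ (inj₁ x≈0) = x≈0
  ... | inj₂ (inj₂ 0<x) =
    contradiction (<-trans 0<x (<-resp-≈ (+-identityˡ x) x+x≈0 (+-mono-< x 0<x))) (<-irrefl-≈ refl)

module DeterminantProperties {c ℓ} (K : OrderedField c ℓ) where
  open OrderedField K hiding (zero)
  open Matrices K
  open OrderedFieldProperties K using (x+x≈0⇒x≈0)
  open import Algebra.Properties.Ring ring
    using (-‿distribˡ-*; -‿distribʳ-*; -‿involutive; -‿+-comm; -0#≈0#; -1*x≈-x; xyx⁻¹≈y)
  open import Algebra.Properties.CommutativeSemigroup +-commutativeSemigroup
    using (interchange) renaming (x∙yz≈y∙xz to x+[y+z]≈y+[x+z])
  open import Algebra.Properties.CommutativeSemigroup *-commutativeSemigroup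
    using () renaming (x∙yz≈y∙xz to x*[y*z]≈y*[x*z])
  open import Relation.Binary.Reasoning.Setoid setoid

  transpose : ∀ {m} → Matrix m → Matrix m
  transpose M i j = M j i

  minor : ∀ {m} → Matrix (suc m) → Fin (suc m) → Matrix m
  minor M j a b = M (suc a) (punchIn j b)

  -- det {suc m} M unfolds definitionally to laplace (M zero) (λ j → det (minor M j)).
  laplace : ∀ {m} → (Fin m → Carrier) → (Fin m → Carrier) → Carrier
  laplace r d = ∑ (λ j → sgn (toℕ j) * (r j * d j))

  -- The rows of identity, by structural recursion so that unit (suc i) (suc j) reduces to unit i j.
  unit : ∀ {m} → Fin m → Fin m → Carrier
  unit zero    zero    = 1#
  unit zero    (suc _) = 0#
  unit (suc _) zero    = 0#
  unit (suc i) (suc j) = unit i j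

  ∑-cong : ∀ {m} {f g : Fin m → Carrier} → (∀ i → f i ≈ g i) → ∑ f ≈ ∑ g
  ∑-cong {zero}  _   = refl
  ∑-cong {suc m} f≈g = +-cong (f≈g zero) (∑-cong (f≈g ∘ suc))

  ∑-zero : ∀ {m} → ∑ {m} (λ _ → 0#) ≈ 0#
  ∑-zero {zero}  = refl
  ∑-zero {suc m} = trans (+-identityˡ _) (∑-zero {m})

  ∑-distrib-+ : ∀ {m} (f g : Fin m → Carrier) → ∑ (λ i → f i + g i) ≈ ∑ f + ∑ g
  ∑-distrib-+ {zero}  f g = sym (+-identityˡ 0#)
  ∑-distrib-+ {suc m} f g = trans (+-congˡ (∑-distrib-+ (f ∘ suc) (g ∘ suc))) (interchange _ _ _ _)

  ∑-comm : ∀ {m k} (f : Fin m → Fin k → Carrier) → ∑ (λ i → ∑ (f i)) ≈ ∑ (λ j → ∑ (λ i → f i j))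
  ∑-comm {zero} {k} f = sym (∑-zero {k})
  ∑-comm {suc m} f = trans (+-congˡ (∑-comm (f ∘ suc))) (sym (∑-distrib-+ (f zero) _))

  *-distribˡ-∑ : ∀ {m} x (f : Fin m → Carrier) → x * ∑ f ≈ ∑ (λ i → x * f i)
  *-distribˡ-∑ {zero}  x f = zeroʳ x
  *-distribˡ-∑ {suc m} x f = trans (distribˡ x _ _) (+-congˡ (*-distribˡ-∑ x (f ∘ suc)))

  ∑-neg : ∀ {m} (f : Fin m → Carrier) → ∑ (λ i → - f i) ≈ - ∑ f
  ∑-neg f = begin
    ∑ (λ i → - f i)       ≈⟨ ∑-cong (λ i → sym (-1*x≈-x (f i))) ⟩
    ∑ (λ i → - 1# * f i)  ≈⟨ *-distribˡ-∑ (- 1#) f ⟨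
    - 1# * ∑ f            ≈⟨ -1*x≈-x (∑ f) ⟩
    - ∑ f                 ∎

  laplace-cong : ∀ {m} {r r′ d d′ : Fin m → Carrier} →
    (∀ j → r j ≈ r′ j) → (∀ j → d j ≈ d′ j) → laplace r d ≈ laplace r′ d′
  laplace-cong r≈r′ d≈d′ = ∑-cong (λ j → *-congˡ (*-cong (r≈r′ j) (d≈d′ j)))

  laplace-congʳ : ∀ {m} (r : Fin m → Carrier) {d d′ : Fin m → Carrier} →
    (∀ j → d j ≈ d′ j) → laplace r d ≈ laplace r d′
  laplace-congʳ r = laplace-cong (λ _ → refl)

  laplace-zeroˡ : ∀ {m} (d : Fin m → Carrier) → laplace (λ _ → 0#) d ≈ 0#
  laplace-zeroˡ {m} d =
    trans (∑-cong (λ j → trans (*-congˡ (zeroˡ (d j))) (zeroʳ (sgn (toℕ j))))) (∑-zero {m})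

  laplace-+ˡ : ∀ {m} (r r′ d : Fin m → Carrier) →
    laplace (λ j → r j + r′ j) d ≈ laplace r d + laplace r′ d
  laplace-+ˡ r r′ d = trans
    (∑-cong (λ j → trans (*-congˡ (distribʳ (d j) (r j) (r′ j))) (distribˡ _ _ _)))
    (∑-distrib-+ (λ j → sgn (toℕ j) * (r j * d j)) (λ j → sgn (toℕ j) * (r′ j * d j)))

  laplace-negˡ : ∀ {m} (r d : Fin m → Carrier) → laplace (λ j → - r j) d ≈ - laplace r d
  laplace-negˡ r d = trans
    (∑-cong (λ j → trans (*-congˡ (sym (-‿distribˡ-* (r j) (d j)))) (sym (-‿distribʳ-* _ _))))
    (∑-neg (λ j → sgn (toℕ j) * (r j * d j)))

  laplace-negʳ : ∀ {m} (r d : Fin m → Carrier) → laplace r (λ j → - d j) ≈ - laplace r d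
  laplace-negʳ r d = trans
    (∑-cong (λ j → trans (*-congˡ (sym (-‿distribʳ-* (r j) (d j)))) (sym (-‿distribʳ-* _ _))))
    (∑-neg (λ j → sgn (toℕ j) * (r j * d j)))

  laplace-suc : ∀ {m} (r d : Fin (suc m) → Carrier) →
    laplace r d ≈ r zero * d zero - laplace (λ j → r (suc j)) (λ j → d (suc j))
  laplace-suc r d = +-cong (*-identityˡ _) (trans
    (∑-cong (λ j → sym (-‿distribˡ-* (sgn (toℕ j)) (r (suc j) * d (suc j)))))
    (∑-neg (λ j → sgn (toℕ j) * (r (suc j) * d (suc j)))))

  laplace-comm : ∀ {m k} (r : Fin m → Carrier) (r′ : Fin k → Carrier)
    (d : Fin m → Fin k → Carrier) →
    laplace r (λ i → laplace r′ (d i)) ≈ laplace r′ (λ j → laplace r (λ i → d i j))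
  laplace-comm r r′ d = begin
    laplace r (λ i → laplace r′ (d i))
      ≈⟨ ∑-cong (λ i → distribute (s i) (r i) (λ j → s j * (r′ j * d i j))) ⟩
    ∑ (λ i → ∑ (λ j → s i * (r i * (s j * (r′ j * d i j)))))
      ≈⟨ ∑-comm (λ i j → s i * (r i * (s j * (r′ j * d i j)))) ⟩
    ∑ (λ j → ∑ (λ i → s i * (r i * (s j * (r′ j * d i j)))))
      ≈⟨ ∑-cong (λ j → ∑-cong (λ i → exchange (s i) (r i) (s j) (r′ j) (d i j))) ⟩
    ∑ (λ j → ∑ (λ i → s j * (r′ j * (s i * (r i * d i j)))))
      ≈⟨ ∑-cong (λ j → distribute (s j) (r′ j) (λ i → s i * (r i * d i j))) ⟨
    laplace r′ (λ j → laplace r (λ i → d i j)) ∎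
    where
    s : ∀ {m} → Fin m → Carrier
    s i = sgn (toℕ i)
    distribute : ∀ {m} x y (f : Fin m → Carrier) → x * (y * ∑ f) ≈ ∑ (λ i → x * (y * f i))
    distribute x y f = trans (*-congˡ (*-distribˡ-∑ y f)) (*-distribˡ-∑ x (λ i → y * f i))
    exchange : ∀ a b c d e → a * (b * (c * (d * e))) ≈ c * (d * (a * (b * e)))
    exchange a b c d e = begin
      a * (b * (c * (d * e)))  ≈⟨ *-congˡ (x*[y*z]≈y*[x*z] b c _) ⟩
      a * (c * (b * (d * e)))  ≈⟨ *-congˡ (*-congˡ (x*[y*z]≈y*[x*z] b d e)) ⟩
      a * (c * (d * (b * e)))  ≈⟨ x*[y*z]≈y*[x*z] a c _ ⟩
      c * (a * (d * (b * e)))  ≈⟨ *-congˡ (x*[y*z]≈y*[x*z] a d _) ⟩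
      c * (d * (a * (b * e)))  ∎

  laplace-unit : ∀ {m} (i : Fin m) (d : Fin m → Carrier) → laplace (unit i) d ≈ sgn (toℕ i) * d i
  laplace-unit zero d = begin
    laplace (unit zero) d                               ≈⟨ laplace-suc (unit zero) d ⟩
    1# * d zero - laplace (λ _ → 0#) (λ j → d (suc j))
      ≈⟨ +-congˡ (trans (-‿cong (laplace-zeroˡ (d ∘ suc))) -0#≈0#) ⟩
    1# * d zero + 0#                                    ≈⟨ +-identityʳ _ ⟩
    1# * d zero                                         ∎
  laplace-unit (suc i) d = begin
    laplace (unit (suc i)) d                          ≈⟨ laplace-suc (unit (suc i)) d ⟩
    0# * d zero - laplace (unit i) (λ j → d (suc j))  ≈⟨ +-cong (zeroˡ _) (-‿cong (laplace-unit i (d ∘ suc))) ⟩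
    0# - sgn (toℕ i) * d (suc i)                      ≈⟨ +-identityˡ _ ⟩
    - (sgn (toℕ i) * d (suc i))                       ≈⟨ -‿distribˡ-* _ _ ⟩
    - sgn (toℕ i) * d (suc i)                         ∎

  det-cong : ∀ {m} {M N : Matrix m} → (∀ i j → M i j ≈ N i j) → det M ≈ det N
  det-cong {zero}  _   = refl
  det-cong {suc m} M≈N = laplace-cong (M≈N zero) (λ j → det-cong (λ a b → M≈N (suc a) (punchIn j b)))

  det-transpose : ∀ {m} (M : Matrix m) → det (transpose M) ≈ det M
  det-transpose {zero}        M = refl
  det-transpose {suc zero}    M = refl
  det-transpose {suc (suc m)} M = begin
    det (transpose M)
      ≈⟨ laplace-suc (λ i → M i zero) (λ j → det (minor (transpose M) j)) ⟩
    M zero zero * det (transpose (minor M zero)) - laplace column (λ i → det (transpose (R i)))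
      ≈⟨ +-cong (*-congˡ (det-transpose {suc m} (minor M zero)))
                (-‿cong (laplace-congʳ column (λ i → det-transpose {suc m} (R i)))) ⟩
    M zero zero * det (minor M zero) - laplace column (λ i → laplace row (λ j → det (C i j)))
      ≈⟨ +-congˡ (-‿cong (laplace-comm column row (λ i j → det (C i j)))) ⟩
    M zero zero * det (minor M zero) - laplace row (λ j → laplace column (λ i → det (C i j)))
      ≈⟨ +-congˡ (-‿cong (laplace-congʳ row (λ j → trans
           (laplace-congʳ column (λ i → sym (det-transpose {m} (C i j))))
           (det-transpose {suc m} (minor M (suc j)))))) ⟩
    M zero zero * det (minor M zero) - laplace row (λ j → det (minor M (suc j)))
      ≈⟨ laplace-suc (M zero) (λ j → det (minor M j)) ⟨
    det M ∎
    where
    row column : Fin (suc m) → Carrier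
    row    j = M zero (suc j)
    column i = M (suc i) zero
    R : Fin (suc m) → Matrix (suc m)
    R i a b = M (punchIn (suc i) a) (suc b)
    C : Fin (suc m) → Fin (suc m) → Matrix m
    C i j a b = M (suc (punchIn i a)) (suc (punchIn j b))

  det-swap₀₁-columns : ∀ {m} (M : Matrix (suc (suc m))) → det (λ i j → M i (swap₀₁ j)) ≈ - det M
  det-swap₀₁-columns {m} M = begin
    det M′
      ≈⟨ expand-twice M′ ⟩
    M zero (suc zero) * det (minor M′ zero) - (M zero zero * det (minor M′ (suc zero)) - T′)
      ≈⟨ +-cong (*-congˡ (det-cong (λ a b → reflexive (≡.cong (M (suc a)) (swap₀₁-suc b)))))
                (-‿cong (+-cong
                  (*-congˡ (det-cong (λ a b → reflexive (≡.cong (M (suc a)) (swap₀₁-punchIn₁ b)))))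
                  (-‿cong (tail-swapped m M)))) ⟩
    M zero (suc zero) * det (minor M (suc zero)) - (M zero zero * det (minor M zero) - - T)
      ≈⟨ exchange _ _ T ⟩
    - (M zero zero * det (minor M zero) - (M zero (suc zero) * det (minor M (suc zero)) - T))
      ≈⟨ -‿cong (expand-twice M) ⟨
    - det M ∎
    where
    M′ : Matrix (suc (suc m))
    M′ i j = M i (swap₀₁ j)
    tail : ∀ {m} → Matrix (suc (suc m)) → Fin m → Carrier
    tail N j = N zero (suc (suc j))
    T T′ : Carrier
    T  = laplace (tail M) (λ j → det (minor M (suc (suc j))))
    T′ = laplace (tail M) (λ j → det (minor M′ (suc (suc j))))
    expand-twice : (N : Matrix (suc (suc m))) →
      det N ≈ N zero zero * det (minor N zero)
              - (N zero (suc zero) * det (minor N (suc zero))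
                 - laplace (tail N) (λ j → det (minor N (suc (suc j)))))
    expand-twice N = trans (laplace-suc (N zero) (λ j → det (minor N j)))
      (+-congˡ (-‿cong (laplace-suc (λ j → N zero (suc j)) (λ j → det (minor N (suc j))))))
    swap₀₁-suc : ∀ {m} (b : Fin (suc m)) → swap₀₁ (suc b) ≡ punchIn (suc zero) b
    swap₀₁-suc zero    = ≡.refl
    swap₀₁-suc (suc b) = ≡.refl
    swap₀₁-punchIn₁ : ∀ {m} (b : Fin (suc m)) → swap₀₁ (punchIn (suc zero) b) ≡ suc b
    swap₀₁-punchIn₁ zero    = ≡.refl
    swap₀₁-punchIn₁ (suc b) = ≡.refl
    swap₀₁-punchIn : ∀ {m} (j : Fin (suc m)) (b : Fin (suc (suc m))) →
      swap₀₁ (punchIn (suc (suc j)) b) ≡ punchIn (suc (suc j)) (swap₀₁ b)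
    swap₀₁-punchIn j zero          = ≡.refl
    swap₀₁-punchIn j (suc zero)    = ≡.refl
    swap₀₁-punchIn j (suc (suc b)) = ≡.refl
    tail-swapped : ∀ m (N : Matrix (suc (suc m))) →
      laplace (tail N) (λ j → det (minor (λ a b → N a (swap₀₁ b)) (suc (suc j))))
        ≈ - laplace (tail N) (λ j → det (minor N (suc (suc j))))
    tail-swapped zero    N = sym -0#≈0#
    tail-swapped (suc m) N = trans
      (laplace-congʳ (tail N) (λ j → trans
        (det-cong (λ a b → reflexive (≡.cong (N (suc a)) (swap₀₁-punchIn j b))))
        (det-swap₀₁-columns (minor N (suc (suc j))))))
      (laplace-negʳ (tail N) (λ j → det (minor N (suc (suc j)))))
    exchange : ∀ x y t → x - (y - - t) ≈ - (y - (x - t))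
    exchange x y t = begin
      x - (y - - t)         ≈⟨ +-congˡ (-‿cong (+-congˡ (-‿involutive t))) ⟩
      x - (y + t)           ≈⟨ +-congˡ (-‿+-comm y t) ⟨
      x + (- y - t)         ≈⟨ x+[y+z]≈y+[x+z] x (- y) (- t) ⟩
      - y + (x - t)         ≈⟨ +-congˡ (-‿involutive (x - t)) ⟨
      - y - - (x - t)       ≈⟨ -‿+-comm y (- (x - t)) ⟩
      - (y - (x - t))       ∎

  det-swapAt-rows : ∀ {m} (k : Fin m) (M : Matrix (suc m)) → det (λ i j → M (swapAt k i) j) ≈ - det M
  det-swapAt-rows {suc m} zero M = begin
    det (λ i j → M (swap₀₁ i) j)  ≈⟨ det-transpose (λ i j → M (swap₀₁ i) j) ⟨
    det (λ i j → M (swap₀₁ j) i)  ≈⟨ det-swap₀₁-columns (transpose M) ⟩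
    - det (transpose M)           ≈⟨ -‿cong (det-transpose M) ⟩
    - det M                       ∎
  det-swapAt-rows (suc k) M = trans
    (laplace-congʳ (M zero) (λ j → det-swapAt-rows k (minor M j)))
    (laplace-negʳ (M zero) (λ j → det (minor M j)))

  det-swapAt-columns : ∀ {m} (k : Fin m) (M : Matrix (suc m)) → det (λ i j → M i (swapAt k j)) ≈ - det M
  det-swapAt-columns k M = begin
    det (λ i j → M i (swapAt k j))  ≈⟨ det-transpose (λ i j → M i (swapAt k j)) ⟨
    det (λ i j → M j (swapAt k i))  ≈⟨ det-swapAt-rows k (transpose M) ⟩
    - det (transpose M)             ≈⟨ -‿cong (det-transpose M) ⟩
    - det M                         ∎

  det-principalSubmatrix-swapAt : ∀ {m} (k : Fin m) (M : Matrix (suc m)) →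
    det (principalSubmatrix M (swapAt k)) ≈ det M
  det-principalSubmatrix-swapAt k M = begin
    det (principalSubmatrix M (swapAt k))  ≈⟨ det-swapAt-rows k (λ i j → M i (swapAt k j)) ⟩
    - det (λ i j → M i (swapAt k j))       ≈⟨ -‿cong (det-swapAt-columns k M) ⟩
    - - det M                              ≈⟨ -‿involutive (det M) ⟩
    det M                                  ∎

  det-principalSubmatrix-swaps : ∀ {m} (ks : List (Fin m)) (M : Matrix (suc m)) →
    det (principalSubmatrix M (applySwaps ks)) ≈ det M
  det-principalSubmatrix-swaps []       M = refl
  det-principalSubmatrix-swaps (k ∷ ks) M =
    trans (det-principalSubmatrix-swaps ks (principalSubmatrix M (swapAt k)))
          (det-principalSubmatrix-swapAt k M)

  det-equal-rows₀₁ : ∀ {m} (M : Matrix (suc (suc m))) → (∀ j → M zero j ≈ M (suc zero) j) → det M ≈ 0#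
  det-equal-rows₀₁ M rows≈ = x+x≈0⇒x≈0 (begin
    det M + det M                         ≈⟨ +-congʳ (det-cong swapped) ⟩
    det (λ i j → M (swap₀₁ i) j) + det M  ≈⟨ +-congʳ (det-swapAt-rows zero M) ⟩
    - det M + det M                       ≈⟨ -‿inverseˡ (det M) ⟩
    0#                                    ∎)
    where
    swapped : ∀ i j → M i j ≈ M (swap₀₁ i) j
    swapped zero          j = rows≈ j
    swapped (suc zero)    j = sym (rows≈ j)
    swapped (suc (suc i)) j = refl

  alien-cofactors : ∀ {m} (M : Matrix (suc (suc m))) → laplace (M (suc zero)) (λ j → det (minor M j)) ≈ 0#
  alien-cofactors M = det-equal-rows₀₁ M′ (λ _ → refl)
    where
    M′ : Matrix _
    M′ zero    = M (suc zero)
    M′ (suc i) = M (suc i)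

  -- After swapping rows 0 and 1 the first row is (row 0) − e₀ − e₁. Expanding along it, row 0
  -- meets alien cofactors and e₀ + e₁ picks out det P − det Q; P and Q differ only by e₀ in
  -- their first row, so det P = det Q + det R.
  det-remove-pair₀₁ : ∀ {m} (N : Matrix (suc (suc m))) →
    (∀ j → N (suc zero) j ≈ N zero j - (unit zero j + unit (suc zero) j)) →
    N zero (suc zero) ≈ N zero zero + 1# →
    (∀ r → N (suc (suc r)) (suc zero) ≈ N (suc (suc r)) zero) →
    det N ≈ det (λ a b → N (suc (suc a)) (suc (suc b)))
  det-remove-pair₀₁ {m} N row₁≈ N₀₁≈ column₁≈ = begin
    det N                                            ≈⟨ -‿involutive (det N) ⟨
    - - det N                                        ≈⟨ -‿cong (det-swapAt-rows zero N) ⟨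
    - det N′                                         ≈⟨ -‿cong (laplace-cong row₁≈ (λ j → refl {D j})) ⟩
    - laplace (λ j → N zero j - E j) D               ≈⟨ -‿cong (trans (laplace-+ˡ (N zero) (λ j → - E j) D)
                                                                       (+-congˡ (laplace-negˡ E D))) ⟩
    - (laplace (N zero) D - laplace E D)             ≈⟨ -‿cong (+-cong (alien-cofactors N′) (-‿cong expand-E)) ⟩
    - (0# - (det P - det Q))                         ≈⟨ trans (-‿cong (+-identityˡ _)) (-‿involutive _) ⟩
    det P - det Q                                    ≈⟨ +-congʳ det-P ⟩
    det Q + det R - det Q                            ≈⟨ xyx⁻¹≈y (det Q) (det R) ⟩
    det R                                            ∎
    where
    N′ P Q : Matrix _
    N′ i = N (swap₀₁ i)
    P = minor N′ zero
    Q = minor N′ (suc zero)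
    R : Matrix m
    R a b = N (suc (suc a)) (suc (suc b))
    E D : Fin (suc (suc m)) → Carrier
    E j = unit zero j + unit (suc zero) j
    D j = det (minor N′ j)
    expand-E : laplace E D ≈ det P - det Q
    expand-E = begin
      laplace E D                                    ≈⟨ laplace-+ˡ (unit zero) (unit (suc zero)) D ⟩
      laplace (unit zero) D + laplace (unit (suc zero)) D
        ≈⟨ +-cong (trans (laplace-unit zero D) (*-identityˡ _))
                (trans (laplace-unit (suc zero) D) (-1*x≈-x _)) ⟩
      det P - det Q                                  ∎
    P₀≈ : ∀ j → P zero j ≈ Q zero j + unit zero j
    P₀≈ zero    = N₀₁≈
    P₀≈ (suc j) = sym (+-identityʳ _)
    P≈Q-below : ∀ a j → P (suc a) j ≈ Q (suc a) j
    P≈Q-below a zero    = column₁≈ a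
    P≈Q-below a (suc j) = refl
    det-P : det P ≈ det Q + det R
    det-P = begin
      det P
        ≈⟨ laplace-cong P₀≈ (λ j → det-cong (λ a b → P≈Q-below a (punchIn j b))) ⟩
      laplace (λ j → Q zero j + unit zero j) (λ j → det (minor Q j))
        ≈⟨ laplace-+ˡ (Q zero) (unit zero) (λ j → det (minor Q j)) ⟩
      det Q + laplace (unit zero) (λ j → det (minor Q j))
        ≈⟨ +-congˡ (trans (laplace-unit zero (λ j → det (minor Q j))) (*-identityˡ _)) ⟩
      det Q + det R                                  ∎

module BlockMatrix {c ℓ} (K : OrderedField c ℓ) {n : ℕ} (A : Matrices.Matrix K n) where
  open OrderedField K hiding (zero)
  open Matrices K
  open OrderedFieldProperties K using (0<1)
  open DeterminantProperties K
  open import Algebra.Properties.Ring ring using (-0#≈0#)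
  open import Relation.Binary.Reasoning.Setoid setoid

  Index : Set
  Index = Fin n ⊎ Fin n

  index : Index → Fin n
  index (inj₁ a) = a
  index (inj₂ a) = a

  entry : Index → Index → Carrier
  entry (inj₁ a) (inj₁ b) = A a b
  entry (inj₁ a) (inj₂ b) = (A ⊕ identity) a b
  entry (inj₂ a) (inj₁ b) = (A ⊖ identity) a b
  entry (inj₂ a) (inj₂ b) = A a b

  submatrix : ∀ {m} → (Fin m → Index) → Matrix m
  submatrix γ i j = entry (γ i) (γ j)

  block≡entry : ∀ i j →
    block A (A ⊕ identity) (A ⊖ identity) A i j ≡ entry (splitAt n i) (splitAt n j)
  block≡entry i j with splitAt n i | splitAt n j
  ... | inj₁ a | inj₁ b = ≡.refl
  ... | inj₁ a | inj₂ b = ≡.refl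
  ... | inj₂ a | inj₁ b = ≡.refl
  ... | inj₂ a | inj₂ b = ≡.refl

  Complementary : Index → Index → Set
  Complementary u v = ∃[ i ] (u ≡ inj₁ i × v ≡ inj₂ i)

  complementary? : ∀ u v → Dec (Complementary u v)
  complementary? (inj₁ a) (inj₂ b) with a Fin.≟ b
  ... | yes ≡.refl = yes (a , ≡.refl , ≡.refl)
  ... | no  a≢b    = no λ { (_ , ≡.refl , ≡.refl) → a≢b ≡.refl }
  complementary? (inj₁ a) (inj₁ b) = no λ { (_ , _ , ()) }
  complementary? (inj₂ a) _        = no λ { (_ , () , _) }

  identity-diagonal : ∀ (a : Fin n) → identity a a ≈ 1#
  identity-diagonal a with a Fin.≟ a
  ... | yes _   = refl
  ... | no  a≢a = contradiction ≡.refl a≢a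

  identity-offDiagonal : ∀ {a b : Fin n} → a ≢ b → identity a b ≈ 0#
  identity-offDiagonal {a} {b} a≢b with a Fin.≟ b
  ... | yes a≡b = contradiction a≡b a≢b
  ... | no  _   = refl

  entry-apart : ∀ u v → index u ≢ index v → entry u v ≈ A (index u) (index v)
  entry-apart (inj₁ a) (inj₁ b) _   = refl
  entry-apart (inj₁ a) (inj₂ b) a≢b = trans (+-congˡ (identity-offDiagonal a≢b)) (+-identityʳ _)
  entry-apart (inj₂ a) (inj₁ b) a≢b =
    trans (+-congˡ (trans (-‿cong (identity-offDiagonal a≢b)) -0#≈0#)) (+-identityʳ _)
  entry-apart (inj₂ a) (inj₂ b) _   = refl

  entry-nonComplementary : ∀ u v → ¬ Complementary u v → ¬ Complementary v u →
    entry u v ≈ A (index u) (index v)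
  entry-nonComplementary (inj₁ a) (inj₁ b) _ _ = refl
  entry-nonComplementary (inj₁ a) (inj₂ b) ¬uv _ =
    entry-apart (inj₁ a) (inj₂ b) (λ { ≡.refl → ¬uv (a , ≡.refl , ≡.refl) })
  entry-nonComplementary (inj₂ a) (inj₁ b) _ ¬vu =
    entry-apart (inj₂ a) (inj₁ b) (λ { ≡.refl → ¬vu (a , ≡.refl , ≡.refl) })
  entry-nonComplementary (inj₂ a) (inj₂ b) _ _ = refl

  index-injective-nonComplementary : ∀ u v → ¬ Complementary u v → ¬ Complementary v u →
    index u ≡ index v → u ≡ v
  index-injective-nonComplementary (inj₁ a) (inj₁ b) _   _   ≡.refl = ≡.refl
  index-injective-nonComplementary (inj₁ a) (inj₂ b) ¬uv _   ≡.refl = contradiction (a , ≡.refl , ≡.refl) ¬uv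
  index-injective-nonComplementary (inj₂ a) (inj₁ b) _   ¬vu ≡.refl = contradiction (a , ≡.refl , ≡.refl) ¬vu
  index-injective-nonComplementary (inj₂ a) (inj₂ b) _   _   ≡.refl = ≡.refl

  NoComplementaryPair : ∀ {m} → (Fin m → Index) → Set
  NoComplementaryPair γ = ∀ p q → ¬ Complementary (γ p) (γ q)

  index∘-injective : ∀ {m} (γ : Fin m → Index) → Injective _≡_ _≡_ γ → NoComplementaryPair γ →
    Injective _≡_ _≡_ (index ∘ γ)
  index∘-injective γ γ-inj noPair {p} {q} =
    γ-inj ∘ index-injective-nonComplementary (γ p) (γ q) (noPair p q) (noPair q p)

  pairThen : ∀ {m} → Fin n → (Fin m → Index) → Fin (suc (suc m)) → Index
  pairThen i γ zero          = inj₁ i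
  pairThen i γ (suc zero)    = inj₂ i
  pairThen i γ (suc (suc r)) = γ r

  det-submatrix-pairThen : ∀ {m} i (γ : Fin m → Index) → (∀ r → index (γ r) ≢ i) →
    det (submatrix (pairThen i γ)) ≈ det (submatrix γ)
  det-submatrix-pairThen i γ apart =
    det-remove-pair₀₁ (submatrix (pairThen i γ)) row₁≈ N₀₁≈ column₁≈
    where
    row₁≈ : ∀ j → entry (inj₂ i) (pairThen i γ j)
                    ≈ entry (inj₁ i) (pairThen i γ j) - (unit zero j + unit (suc zero) j)
    row₁≈ zero          = +-congˡ (-‿cong (trans (identity-diagonal i) (sym (+-identityʳ 1#))))
    row₁≈ (suc zero)    = sym (begin
      A i i + identity i i - (0# + 1#)  ≈⟨ +-cong (+-congˡ (identity-diagonal i)) (-‿cong (+-identityˡ 1#)) ⟩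
      A i i + 1# - 1#                   ≈⟨ +-assoc _ _ _ ⟩
      A i i + (1# - 1#)                 ≈⟨ +-congˡ (-‿inverseʳ 1#) ⟩
      A i i + 0#                        ≈⟨ +-identityʳ _ ⟩
      A i i                             ∎)
    row₁≈ (suc (suc r)) = begin
      entry (inj₂ i) (γ r)              ≈⟨ entry-apart (inj₂ i) (γ r) (apart r ∘ ≡.sym) ⟩
      A i (index (γ r))                 ≈⟨ entry-apart (inj₁ i) (γ r) (apart r ∘ ≡.sym) ⟨
      entry (inj₁ i) (γ r)              ≈⟨ +-identityʳ _ ⟨
      entry (inj₁ i) (γ r) + 0#         ≈⟨ +-congˡ (trans (-‿cong (+-identityˡ 0#)) -0#≈0#) ⟨
      entry (inj₁ i) (γ r) - (0# + 0#)  ∎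
    N₀₁≈ : entry (inj₁ i) (inj₂ i) ≈ entry (inj₁ i) (inj₁ i) + 1#
    N₀₁≈ = +-congˡ (identity-diagonal i)
    column₁≈ : ∀ r → entry (γ r) (inj₂ i) ≈ entry (γ r) (inj₁ i)
    column₁≈ r =
      trans (entry-apart (γ r) (inj₂ i) (apart r)) (sym (entry-apart (γ r) (inj₁ i) (apart r)))

  remove-complementary : ∀ {m} (γ : Fin (suc (suc m)) → Index) → Injective _≡_ _≡_ γ →
    ∀ {p q} → Complementary (γ p) (γ q) →
    ∃[ γ′ ] (Injective _≡_ _≡_ γ′ × det (submatrix γ) ≈ det (submatrix γ′))
  remove-complementary {m} γ γ-inj {p} {q} (i , γp≡inj₁ , γq≡inj₂) = γ′ , γ′-inj , (begin
    det (submatrix γ)                ≈⟨ det-principalSubmatrix-swaps ks (submatrix γ) ⟨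
    det (submatrix (γ ∘ π))          ≈⟨ det-cong (λ a b → reflexive (≡.cong₂ entry (γπ≗ a) (γπ≗ b))) ⟩
    det (submatrix (pairThen i γ′))  ≈⟨ det-submatrix-pairThen i γ′ apart ⟩
    det (submatrix γ′)               ∎)
    where
    p≢q : p ≢ q
    p≢q ≡.refl = contradiction (≡.trans (≡.sym γp≡inj₁) γq≡inj₂) λ ()
    ks : List (Fin (suc m))
    ks = p ◃ moveTo (punchOut p≢q)
    π : Fin (suc (suc m)) → Fin (suc (suc m))
    π = applySwaps ks
    γ′ : Fin m → Index
    γ′ r = γ (π (suc (suc r)))
    γπ≗ : ∀ a → γ (π a) ≡ pairThen i γ′ a
    γπ≗ zero          = ≡.trans (≡.cong γ (◃-zero p _)) γp≡inj₁
    γπ≗ (suc zero)    = ≡.trans (≡.cong γ π₁≡q) γq≡inj₂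
      where
      π₁≡q : π (suc zero) ≡ q
      π₁≡q = ≡.trans (◃-suc p _ zero)
               (≡.trans (≡.cong (punchIn p) (applySwaps-moveTo-zero _)) (Fin.punchIn-punchOut p≢q))
    γπ≗ (suc (suc r)) = ≡.refl
    γ′-inj : Injective _≡_ _≡_ γ′
    γ′-inj = Fin.suc-injective ∘ Fin.suc-injective ∘ applySwaps-injective ks ∘ γ-inj
    apart : ∀ r → index (γ′ r) ≢ i
    apart r = apart′ (γ′ r) ≡.refl
      where
      apart′ : ∀ u → γ′ r ≡ u → index u ≢ i
      apart′ (inj₁ a) γ′r≡u ≡.refl = Fin.0≢1+n (≡.sym
        (applySwaps-injective ks (γ-inj (≡.trans γ′r≡u (≡.sym (γπ≗ zero))))))
      apart′ (inj₂ a) γ′r≡u ≡.refl = Fin.0≢1+n (≡.sym (Fin.suc-injective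
        (applySwaps-injective ks (γ-inj (≡.trans γ′r≡u (≡.sym (γπ≗ (suc zero))))))))

  module _ (A-isP : IsPMatrix A) where

    det-submatrix-pos-noPair : ∀ {m} (γ : Fin (suc m) → Index) → Injective _≡_ _≡_ γ →
      NoComplementaryPair γ → 0# < det (submatrix γ)
    det-submatrix-pos-noPair {m} γ γ-inj noPair
      with sortingSwaps (index ∘ γ) (index∘-injective γ γ-inj noPair)
    ... | ks , sorted = <-resp-≈ refl (begin
      det (principalSubmatrix A (index ∘ γ ∘ applySwaps ks))
        ≈⟨ det-cong (λ a b → sym (entry-nonComplementary (γ (π a)) (γ (π b))
                                   (noPair (π a) (π b)) (noPair (π b) (π a)))) ⟩
      det (submatrix (γ ∘ applySwaps ks))  ≈⟨ det-principalSubmatrix-swaps ks (submatrix γ) ⟩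
      det (submatrix γ)                    ∎)
      (A-isP m (index ∘ γ ∘ applySwaps ks) sorted)
      where
      π : Fin (suc m) → Fin (suc m)
      π = applySwaps ks

    det-submatrix-pos : ∀ m (γ : Fin m → Index) → Injective _≡_ _≡_ γ → 0# < det (submatrix γ)
    det-submatrix-pos zero          γ _     = 0<1
    det-submatrix-pos (suc zero)    γ γ-inj = det-submatrix-pos-noPair γ γ-inj
      λ { zero zero (_ , γ₀≡inj₁ , γ₀≡inj₂) →
            contradiction (≡.trans (≡.sym γ₀≡inj₁) γ₀≡inj₂) λ () }
    det-submatrix-pos (suc (suc m)) γ γ-inj =
      byPair (Fin.any? (λ p → Fin.any? (λ q → complementary? (γ p) (γ q))))
      where
      byPair : Dec (∃[ p ] ∃[ q ] Complementary (γ p) (γ q)) → 0# < det (submatrix γ)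
      byPair (no noPair)       = det-submatrix-pos-noPair γ γ-inj (λ p q c → noPair (p , q , c))
      byPair (yes (p , q , c)) =
        let γ′ , γ′-inj , det≈ = remove-complementary γ γ-inj c
        in <-resp-≈ refl (sym det≈) (det-submatrix-pos m γ′ γ′-inj)

lemma5 : ∀ {c ℓ} (K : OrderedField c ℓ) → let open Matrices K in
    ∀ (n : ℕ) (A : Matrix n) → IsPMatrix A →
    IsPMatrix (block A (A ⊕ identity) (A ⊖ identity) A)
lemma5 K n A A-isP k σ σ-increasing =
  <-resp-≈ refl (sym (det-cong (λ a b → reflexive (block≡entry (σ a) (σ b)))))
    (det-submatrix-pos A-isP (suc k) (splitAt n ∘ σ) (σ-inj ∘ splitAt-injective n))
  where
  open OrderedField K hiding (zero)
  open DeterminantProperties K using (det-cong)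
  open BlockMatrix K A using (block≡entry; det-submatrix-pos)
  σ-inj : Injective _≡_ _≡_ σ
  σ-inj = strictlyIncreasing⇒injective σ σ-increasing
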